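{- Let $A$ be a finite non-empty alphabet. Let $\lambda$ be a left-infinite word and $\rho$ a right-infinite word over $A$, both ultimately periodic and having the same set of period words, with canonical forms $\lambda={}^{\omega}u\,w_1$ and $\rho=w_2\,v^{\omega}$, and let $p=|u|$ $(=|v|)$. Assume $|w_1|\geq |w_2|$ and put $M=|w_1|+p-1$. Then $rog(\lambda_n,\rho_n)\leq M$ for every $n\in\mathbb{N}$.
   Context: $A^*$ is the free monoid of finite words and $A^+$ the non-empty words; $\mathbb{N}=\{0,1,2,\dots\}$. A left-infinite word is a sequence $\cdots a_{ -2}a_{ -1}a_0$ indexed by $-\mathbb{N}$; a right-infinite word is a sequence $a_0a_1\cdots$ indexed by $\mathbb{N}$. For $u\in A^+$, $w\in A^*$, ${}^{\omega}u\,w=\cdots uuuw$ and $w\,u^{\omega}=wuuu\cdots$. A left-infinite (resp. right-infinite) word is ultimately periodic if it equals ${}^{\omega}u\,w$ (resp. $w\,u^{\omega}$) for some $u\in A^+$, $w\in A^*$; such $u$ is called a period word. For an ultimately periodic word there are unique words $u,w$ of shortest length with $\lambda={}^{\omega}u\,w$ (resp. $\rho=w\,u^{\omega}$); this is its canonical form. Under the hypothesis the canonical period words $u,v$ are conjugate, so $|u|=|v|$. For $n\in\mathbb{N}$, $\lambda_n$ is the suffix of length $n$ of $\lambda$ and $\rho_n$ the prefix of length $n$ of $\rho$. For finite words $s,t$ of equal length, $rog(s,t)=\min\{n\in\mathbb{N}: xs=tx' \text{ for some } x,x'\in A^n\}$. -}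

module Defs where

open import Data.Nat using (ℕ; _+_; _*_; _≤_)
open import Data.List using (List; []; _++_; map; reverse; upTo; concat; replicate; length)
open import Data.Product using (Σ; _×_; ∃-syntax)
open import Relation.Binary.PropositionalEquality using (_≡_; _≢_)

-- Finite words over A are lists.  A left-infinite word ⋯a₋₂a₋₁a₀ is a function
-- λ : ℕ → A with λ i = a₋ᵢ; a right-infinite word a₀a₁⋯ is ρ : ℕ → A with ρ i = aᵢ.
LeftWord : Set → Set
LeftWord A = ℕ → A

RightWord : Set → Set
RightWord A = ℕ → A

suffixL : {A : Set} → LeftWord A → ℕ → List A
suffixL λw n = reverse (map λw (upTo n))

prefixR : {A : Set} → RightWord A → ℕ → List A
prefixR ρ n = map ρ (upTo n)

-- λ = ^ω u w  (u non-empty): every suffix u^k w of ^ω u w is a suffix of λ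
-- (these suffixes determine every letter of ^ω u w).
IsLeftForm : {A : Set} → LeftWord A → List A → List A → Set
IsLeftForm λw u w =
  u ≢ [] × (∀ k → suffixL λw (k * length u + length w) ≡ concat (replicate k u) ++ w)

IsRightForm : {A : Set} → RightWord A → List A → List A → Set
IsRightForm ρ w u =
  u ≢ [] × (∀ k → prefixR ρ (length w + k * length u) ≡ w ++ concat (replicate k u))

IsLeftPeriod : {A : Set} → LeftWord A → List A → Set
IsLeftPeriod λw u = ∃[ w ] IsLeftForm λw u w

IsRightPeriod : {A : Set} → RightWord A → List A → Set
IsRightPeriod ρ u = ∃[ w ] IsRightForm ρ w u

IsLeftCanonical : {A : Set} → LeftWord A → List A → List A → Set
IsLeftCanonical λw u w =
  IsLeftForm λw u w ×
  (∀ u' w' → IsLeftForm λw u' w' → length u ≤ length u' × length w ≤ length w')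

IsRightCanonical : {A : Set} → RightWord A → List A → List A → Set
IsRightCanonical ρ w u =
  IsRightForm ρ w u ×
  (∀ w' u' → IsRightForm ρ w' u' → length w ≤ length w' × length u ≤ length u')

RogWitness : {A : Set} → List A → List A → ℕ → Set
RogWitness {A} s t n =
  Σ (List A) λ x → Σ (List A) λ x' →
    length x ≡ n × length x' ≡ n × x ++ s ≡ t ++ x'

IsRog : {A : Set} → List A → List A → ℕ → Set
IsRog s t r = RogWitness s t r × (∀ m → RogWitness s t m → r ≤ m)

{-# OPTIONS --safe #-}
-- Write p = |u| = |v| and ρ = w′ u^ω (u is a period word of ρ).  Past |w₁| the letters of λ,
-- and past |w₂| those of ρ, depend only on the position mod p, and both are read off u:
-- λ(i) = ρ(j) as soon as i + j + 1 ≡ |w₁| + |w′| (mod p).  For n < |w₁| + p the trivial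
-- witness r = n works.  Otherwise pick r ∈ [|w₁|, |w₁| + p) with r + n ≡ |w₁| + |w′| (mod p);
-- then λₙ = s λᵣ and ρₙ = ρᵣ s for one word s, so r is a witness, and the least witness is
-- found by a bounded search.
module Submission where

open import Defs
open import Data.Nat using (ℕ; zero; suc; _+_; _*_; _∸_; _≤_; _<_; _≥_; s≤s; s≤s⁻¹; NonZero)
open import Data.Nat.Properties
open import Data.Nat.DivMod using (_%_; _/_; m≡m%n+[m/n]*n; m%n<n)
open import Data.Nat.Tactic.RingSolver using (solve-∀; solve)
open import Data.Fin using (Fin)
open import Data.Fin.Properties using () renaming (_≟_ to _≟ᶠ_)
open import Data.List
  using (List; []; _∷_; length; _++_; map; reverse; upTo; applyUpTo; applyDownFrom; concat; replicate; take; drop)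
open import Data.List.Properties
  using (∷-injective; ++-assoc; length-map; length-take; length-drop; length-applyUpTo;
         length-applyDownFrom; map-upTo; reverse-applyUpTo; take++drop≡id; ≡-dec)
open import Data.Maybe using (Maybe; just; nothing)
open import Data.Maybe.Properties using (just-injective)
open import Data.Product using (_×_; ∃-syntax; _,_; proj₁; proj₂)
open import Data.Sum using (_⊎_; inj₁; inj₂; [_,_]′)
open import Function.Bundles using (_⇔_; Equivalence)
open import Relation.Binary.PropositionalEquality
open import Relation.Binary.Definitions using (DecidableEquality)
open import Relation.Nullary using (¬_; Dec; yes; no)
open import Relation.Nullary.Decidable using (map′)
open import Data.Empty using (⊥-elim)

last-block-offset : ∀ b s t W → suc b * suc (s + t) + W ≡ suc t + (W + (b * suc (s + t) + s))
last-block-offset = solve-∀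

shift-by-multiple : ∀ a k p t → a * p + t + k * p ≡ (a + k) * p + t
shift-by-multiple = solve-∀

module _ {A : Set} where

  _‼_ : List A → ℕ → Maybe A
  []       ‼ _     = nothing
  (x ∷ xs) ‼ zero  = just x
  (x ∷ xs) ‼ suc k = xs ‼ k

  ‼-++ˡ : ∀ (xs ys : List A) {k} → k < length xs → (xs ++ ys) ‼ k ≡ xs ‼ k
  ‼-++ˡ (x ∷ xs) ys {zero}  _         = refl
  ‼-++ˡ (x ∷ xs) ys {suc k} (s≤s k<n) = ‼-++ˡ xs ys k<n

  ‼-++ʳ : ∀ (xs ys : List A) k → (xs ++ ys) ‼ (length xs + k) ≡ ys ‼ k
  ‼-++ʳ []       ys k = refl
  ‼-++ʳ (x ∷ xs) ys k = ‼-++ʳ xs ys k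

  ‼-applyUpTo : ∀ (f : ℕ → A) {n k} → k < n → applyUpTo f n ‼ k ≡ just (f k)
  ‼-applyUpTo f {suc n} {zero}  _         = refl
  ‼-applyUpTo f {suc n} {suc k} (s≤s k<n) = ‼-applyUpTo (λ i → f (suc i)) k<n

  ‼-applyDownFrom : ∀ (f : ℕ → A) {n k} → k < n → applyDownFrom f n ‼ k ≡ just (f (n ∸ suc k))
  ‼-applyDownFrom f {suc n} {zero}  _         = refl
  ‼-applyDownFrom f {suc n} {suc k} (s≤s k<n) = ‼-applyDownFrom f k<n

  ‼-concat-replicate : ∀ (u : List A) a {t} → t < length u →
                       concat (replicate (suc a) u) ‼ (a * length u + t) ≡ u ‼ t
  ‼-concat-replicate u zero    t<p = ‼-++ˡ u _ t<p
  ‼-concat-replicate u (suc a) {t} t<p = begin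
    (u ++ concat (replicate (suc a) u)) ‼ (length u + a * length u + t)
      ≡⟨ cong ((u ++ concat (replicate (suc a) u)) ‼_) (+-assoc (length u) _ t) ⟩
    (u ++ concat (replicate (suc a) u)) ‼ (length u + (a * length u + t))
      ≡⟨ ‼-++ʳ u _ _ ⟩
    concat (replicate (suc a) u) ‼ (a * length u + t)
      ≡⟨ ‼-concat-replicate u a t<p ⟩
    u ‼ t ∎
    where open ≡-Reasoning

  applyUpTo-+ : ∀ (f : ℕ → A) r m → applyUpTo f (r + m) ≡ applyUpTo f r ++ applyUpTo (λ k → f (r + k)) m
  applyUpTo-+ f zero    m = refl
  applyUpTo-+ f (suc r) m = cong (f 0 ∷_) (applyUpTo-+ (λ k → f (suc k)) r m)

  applyDownFrom-+ : ∀ (f : ℕ → A) r m →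
                    applyDownFrom f (r + m) ≡ applyDownFrom (λ k → f (r + k)) m ++ applyDownFrom f r
  applyDownFrom-+ f r zero    = cong (applyDownFrom f) (+-identityʳ r)
  applyDownFrom-+ f r (suc m) = trans (cong (applyDownFrom f) (+-suc r m))
                                      (cong (f (r + m) ∷_) (applyDownFrom-+ f r m))

  applyUpTo≡applyDownFrom : ∀ (f g : ℕ → A) m → (∀ i j → suc (i + j) ≡ m → f i ≡ g j) →
                            applyUpTo f m ≡ applyDownFrom g m
  applyUpTo≡applyDownFrom f g zero    agree = refl
  applyUpTo≡applyDownFrom f g (suc m) agree =
    cong₂ _∷_ (agree 0 m refl)
              (applyUpTo≡applyDownFrom (λ i → f (suc i)) g m (λ i j e → agree (suc i) j (cong suc e)))

  suffixL≡applyDownFrom : ∀ (λw : LeftWord A) n → suffixL λw n ≡ applyDownFrom λw n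
  suffixL≡applyDownFrom λw n = trans (cong reverse (map-upTo λw n)) (reverse-applyUpTo λw n)

  length-suffixL : ∀ (λw : LeftWord A) n → length (suffixL λw n) ≡ n
  length-suffixL λw n = trans (cong length (suffixL≡applyDownFrom λw n)) (length-applyDownFrom λw n)

  length-prefixR : ∀ (ρ : RightWord A) n → length (prefixR ρ n) ≡ n
  length-prefixR ρ n = trans (length-map ρ (upTo n)) (length-applyUpTo (λ k → k) n)

  leftForm-letter : ∀ {λw : LeftWord A} {u w : List A} {p} → IsLeftForm λw u w → length u ≡ p →
                    ∀ b {s t} → suc (s + t) ≡ p → u ‼ t ≡ just (λw (length w + (b * p + s)))
  leftForm-letter {λw} {u} {w} (_ , form) |u|≡p b {s} {t} refl = begin
    u ‼ t                                          ≡⟨ ‼-++ˡ u (concat (replicate b u) ++ w) t<|u| ⟨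
    (u ++ (concat (replicate b u) ++ w)) ‼ t       ≡⟨ cong (_‼ t) (++-assoc u (concat (replicate b u)) w) ⟨
    (concat (replicate (suc b) u) ++ w) ‼ t        ≡⟨ cong (_‼ t) (form (suc b)) ⟨
    suffixL λw (suc b * length u + length w) ‼ t   ≡⟨ cong (λ p → suffixL λw (suc b * p + length w) ‼ t) |u|≡p ⟩
    suffixL λw N ‼ t                               ≡⟨ cong (_‼ t) (suffixL≡applyDownFrom λw N) ⟩
    applyDownFrom λw N ‼ t                         ≡⟨ ‼-applyDownFrom λw t<N ⟩
    just (λw (N ∸ suc t))                          ≡⟨ cong (λ i → just (λw (i ∸ suc t))) N≡ ⟩
    just (λw (suc t + (length w + (b * p + s)) ∸ suc t)) ≡⟨ cong (λ i → just (λw i)) (m+n∸m≡n (suc t) _) ⟩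
    just (λw (length w + (b * p + s)))             ∎
    where
    open ≡-Reasoning
    p = suc (s + t)
    N = suc b * p + length w
    t<|u| : t < length u
    t<|u| = subst (t <_) (sym |u|≡p) (s≤s (m≤n+m t s))
    N≡ : N ≡ suc t + (length w + (b * p + s))
    N≡ = last-block-offset b s t (length w)
    t<N : t < N
    t<N = subst (t <_) (sym N≡) (s≤s (m≤m+n t _))

  rightForm-letter : ∀ {ρ : RightWord A} {w u : List A} {p} → IsRightForm ρ w u → length u ≡ p →
                     ∀ a {t} → t < p → u ‼ t ≡ just (ρ (length w + (a * p + t)))
  rightForm-letter {ρ} {w} {u} (_ , form) refl a {t} t<p = begin
    u ‼ t                                                  ≡⟨ ‼-concat-replicate u a t<p ⟨
    concat (replicate (suc a) u) ‼ (a * length u + t)      ≡⟨ ‼-++ʳ w _ _ ⟨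
    (w ++ concat (replicate (suc a) u)) ‼ i                ≡⟨ cong (_‼ i) (form (suc a)) ⟨
    prefixR ρ N ‼ i                                        ≡⟨ cong (_‼ i) (map-upTo ρ N) ⟩
    applyUpTo ρ N ‼ i                                      ≡⟨ ‼-applyUpTo ρ i<N ⟩
    just (ρ i)                                             ∎
    where
    open ≡-Reasoning
    i = length w + (a * length u + t)
    N = length w + suc a * length u
    i<N : i < N
    i<N = +-monoʳ-< (length w) (subst (a * length u + t <_) (+-comm (a * length u) (length u))
                                      (+-monoʳ-< (a * length u) t<p))

  rightForm-periodic : ∀ {ρ : RightWord A} {w u : List A} {p} .{{_ : NonZero p}} →
                       IsRightForm ρ w u → length u ≡ p →
                       ∀ {j} → length w ≤ j → ∀ k → ρ (j + k * p) ≡ ρ j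
  rightForm-periodic {ρ} {w} {u} {p} form |u|≡p {j} w≤j k = just-injective (begin
    just (ρ (j + k * p))                       ≡⟨ cong (λ i → just (ρ i)) j+kp≡ ⟩
    just (ρ (length w + ((a + k) * p + t)))    ≡⟨ rightForm-letter form |u|≡p (a + k) t<p ⟨
    u ‼ t                                      ≡⟨ rightForm-letter form |u|≡p a t<p ⟩
    just (ρ (length w + (a * p + t)))          ≡⟨ cong (λ i → just (ρ i)) j≡ ⟨
    just (ρ j)                                 ∎)
    where
    open ≡-Reasoning
    e = j ∸ length w
    t = e % p
    a = e / p
    t<p : t < p
    t<p = m%n<n e p
    j≡ : j ≡ length w + (a * p + t)
    j≡ = trans (sym (m+[n∸m]≡n w≤j)) (cong (length w +_) (trans (m≡m%n+[m/n]*n e p) (+-comm t (a * p))))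
    j+kp≡ : j + k * p ≡ length w + ((a + k) * p + t)
    j+kp≡ = trans (cong (_+ k * p) j≡)
                  (trans (+-assoc (length w) _ (k * p)) (cong (length w +_) (shift-by-multiple a k p t)))

  rogWitness-shift : ∀ (λw : LeftWord A) (ρ : RightWord A) r m →
                     (∀ i j → suc (i + j) ≡ m → ρ (r + i) ≡ λw (r + j)) →
                     RogWitness (suffixL λw (r + m)) (prefixR ρ (r + m)) r
  rogWitness-shift λw ρ r m agree =
    prefixR ρ r , suffixL λw r , length-prefixR ρ r , length-suffixL λw r , (begin
      prefixR ρ r ++ suffixL λw (r + m)
        ≡⟨ cong (prefixR ρ r ++_) (trans (suffixL≡applyDownFrom λw (r + m)) (applyDownFrom-+ λw r m)) ⟩
      prefixR ρ r ++ (applyDownFrom (λ k → λw (r + k)) m ++ applyDownFrom λw r)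
        ≡⟨ cong (λ xs → prefixR ρ r ++ (xs ++ applyDownFrom λw r)) (applyUpTo≡applyDownFrom _ _ m agree) ⟨
      prefixR ρ r ++ (applyUpTo (λ k → ρ (r + k)) m ++ applyDownFrom λw r)
        ≡⟨ ++-assoc (prefixR ρ r) _ _ ⟨
      (prefixR ρ r ++ applyUpTo (λ k → ρ (r + k)) m) ++ applyDownFrom λw r
        ≡⟨ cong₂ _++_ prefix-+ (sym (suffixL≡applyDownFrom λw r)) ⟩
      prefixR ρ (r + m) ++ suffixL λw r ∎)
    where
    open ≡-Reasoning
    prefix-+ : prefixR ρ r ++ applyUpTo (λ k → ρ (r + k)) m ≡ prefixR ρ (r + m)
    prefix-+ = trans (cong (_++ applyUpTo (λ k → ρ (r + k)) m) (map-upTo ρ r))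
                     (trans (sym (applyUpTo-+ ρ r m)) (sym (map-upTo ρ (r + m))))

  ++-split : ∀ (xs ys : List A) {zs ws} → length xs ≡ length ys → xs ++ zs ≡ ys ++ ws →
             xs ≡ ys × zs ≡ ws
  ++-split []       []       _   eq = refl , eq
  ++-split (x ∷ xs) (y ∷ ys) len eq with ∷-injective eq
  ... | refl , eq′ with ++-split xs ys (suc-injective len) eq′
  ...   | refl , zs≡ws = refl , zs≡ws

  module _ {s t : List A} {n m} (|s|≡n : length s ≡ n) (|t|≡n : length t ≡ n) (m≤n : m ≤ n) where

    private
      |take|≡m : length (take m t) ≡ m
      |take|≡m = trans (length-take m t) (m≤n⇒m⊓n≡m (subst (m ≤_) (sym |t|≡n) m≤n))

      |drop|≡m : length (drop (n ∸ m) s) ≡ m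
      |drop|≡m = trans (length-drop (n ∸ m) s) (trans (cong (_∸ (n ∸ m)) |s|≡n) (m∸[m∸n]≡n m≤n))

    rogWitness⇒drop≡take : RogWitness s t m → drop m t ≡ take (n ∸ m) s
    rogWitness⇒drop≡take (x , x′ , |x|≡m , _ , eq) = sym (proj₁ (++-split _ _ |take′|≡|drop| s≡))
      where
      t≡ : t ≡ take m t ++ drop m t
      t≡ = sym (take++drop≡id m t)
      s≡drop++x′ : s ≡ drop m t ++ x′
      s≡drop++x′ = proj₂ (++-split x (take m t) (trans |x|≡m (sym |take|≡m))
                            (trans eq (trans (cong (_++ x′) t≡) (++-assoc (take m t) _ x′))))
      s≡ : take (n ∸ m) s ++ drop (n ∸ m) s ≡ drop m t ++ x′
      s≡ = trans (take++drop≡id (n ∸ m) s) s≡drop++x′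
      |take′|≡|drop| : length (take (n ∸ m) s) ≡ length (drop m t)
      |take′|≡|drop| = trans (length-take (n ∸ m) s)
        (trans (m≤n⇒m⊓n≡m (subst (n ∸ m ≤_) (sym |s|≡n) (m∸n≤m n m)))
               (sym (trans (length-drop m t) (cong (_∸ m) |t|≡n))))

    drop≡take⇒rogWitness : drop m t ≡ take (n ∸ m) s → RogWitness s t m
    drop≡take⇒rogWitness eq = take m t , drop (n ∸ m) s , |take|≡m , |drop|≡m , (begin
      take m t ++ s                                       ≡⟨ cong (take m t ++_) (take++drop≡id (n ∸ m) s) ⟨
      take m t ++ (take (n ∸ m) s ++ drop (n ∸ m) s)      ≡⟨ cong (λ xs → take m t ++ (xs ++ drop (n ∸ m) s)) eq ⟨
      take m t ++ (drop m t ++ drop (n ∸ m) s)            ≡⟨ ++-assoc (take m t) _ _ ⟨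
      (take m t ++ drop m t) ++ drop (n ∸ m) s            ≡⟨ cong (_++ drop (n ∸ m) s) (take++drop≡id m t) ⟩
      t ++ drop (n ∸ m) s                                 ∎)
      where open ≡-Reasoning

    rogWitness? : DecidableEquality A → Dec (RogWitness s t m)
    rogWitness? _≟_ = map′ drop≡take⇒rogWitness rogWitness⇒drop≡take (≡-dec _≟_ (drop m t) (take (n ∸ m) s))

module _ {P : ℕ → Set} where

  least-below : ∀ B → (∀ m → m < B → Dec (P m)) →
                (∃[ r ] (r < B × P r × ∀ m → P m → r ≤ m)) ⊎ (∀ m → m < B → ¬ P m)
  least-below zero    P? = inj₂ (λ m ())
  least-below (suc B) P? with least-below B (λ m m<B → P? m (m<n⇒m<1+n m<B))
  ... | inj₁ (r , r<B , Pr , r-least) = inj₁ (r , m<n⇒m<1+n r<B , Pr , r-least)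
  ... | inj₂ none with P? B (n<1+n B)
  ...   | yes PB  = inj₁ (B , n<1+n B , PB , λ m Pm → ≮⇒≥ (λ m<B → none m m<B Pm))
  ...   | no  ¬PB = inj₂ λ m m<1+B Pm → [ (λ m<B → none m m<B Pm) , (λ { refl → ¬PB Pm }) ]′ (m<1+n⇒m<n∨m≡n m<1+B)

  least-at-most : ∀ B → (∀ m → m < B → Dec (P m)) → P B → ∃[ r ] (r ≤ B × P r × ∀ m → P m → r ≤ m)
  least-at-most B P? PB with least-below B P?
  ... | inj₁ (r , r<B , Pr , r-least) = r , <⇒≤ r<B , Pr , r-least
  ... | inj₂ none = B , ≤-refl , PB , λ m Pm → ≮⇒≥ (λ m<B → none m m<B Pm)

complementary-residues : ∀ {s t p} x y → s < p → t < p → suc (s + t) + x * p ≡ y * p → suc (s + t) ≡ p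
complementary-residues {s} {t} {p} x y s<p t<p eq = by-multiplier (y ∸ x) (begin
  suc (s + t)                ≡⟨ m+n∸n≡m (suc (s + t)) (x * p) ⟨
  suc (s + t) + x * p ∸ x * p ≡⟨ cong (_∸ x * p) eq ⟩
  y * p ∸ x * p              ≡⟨ *-distribʳ-∸ p y x ⟨
  (y ∸ x) * p                ∎)
  where
  open ≡-Reasoning
  by-multiplier : ∀ k → suc (s + t) ≡ k * p → suc (s + t) ≡ p
  by-multiplier zero          ()
  by-multiplier (suc zero)    e = trans e (+-identityʳ p)
  by-multiplier (suc (suc k)) e =
    ⊥-elim (<-irrefl e (<-≤-trans (+-mono-≤-< s<p t<p) (+-monoʳ-≤ p (m≤m+n p (k * p)))))

J+W′[1+q] : ∀ J W′ q → J + W′ * suc q ≡ W′ + (J + W′ * q)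
J+W′[1+q] = solve-∀

residues-congruence : ∀ W₁ W′ I J a b c e s t q →
  I ≡ W₁ + (c * suc q + s) → J + W′ * q ≡ e * suc q + t →
  suc (I + J) + a * suc q ≡ W₁ + W′ + b * suc q →
  suc (s + t) + (c + e + a) * suc q ≡ (W′ + b) * suc q
residues-congruence W₁ W′ _ J a b c e s t q refl hJ h = +-cancelʳ-≡ _ _ _ (begin
  suc (s + t) + (c + e + a) * suc q + (W₁ + (J + W′ * q))
    ≡⟨ solve (W₁ ∷ W′ ∷ J ∷ a ∷ c ∷ e ∷ s ∷ t ∷ q ∷ []) ⟩
  suc (W₁ + (c * suc q + s) + J) + a * suc q + (W′ * q + (e * suc q + t))
    ≡⟨ cong₂ (λ x y → x + (W′ * q + y)) h (sym hJ) ⟩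
  W₁ + W′ + b * suc q + (W′ * q + (J + W′ * q))
    ≡⟨ solve (W₁ ∷ W′ ∷ J ∷ b ∷ q ∷ []) ⟩
  (W′ + b) * suc q + (W₁ + (J + W′ * q)) ∎)
  where open ≡-Reasoning

choice-congruence : ∀ W₁ W′ d a i j {n} q → W₁ + d + suc (i + j) ≡ n → W′ + n * q ≡ d + a * suc q →
  suc ((W₁ + d + j) + (W₁ + d + i)) + a * suc q ≡ W₁ + W′ + n * suc q
choice-congruence W₁ W′ d a i j q refl h = begin
  suc ((W₁ + d + j) + (W₁ + d + i)) + a * suc q
    ≡⟨ solve (W₁ ∷ d ∷ a ∷ i ∷ j ∷ q ∷ []) ⟩
  W₁ + (W₁ + d + suc (i + j)) + (d + a * suc q)
    ≡⟨ cong (W₁ + (W₁ + d + suc (i + j)) +_) h ⟨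
  W₁ + (W₁ + d + suc (i + j)) + (W′ + (W₁ + d + suc (i + j)) * q)
    ≡⟨ solve (W₁ ∷ W′ ∷ d ∷ i ∷ j ∷ q ∷ []) ⟩
  W₁ + W′ + (W₁ + d + suc (i + j)) * suc q ∎
  where open ≡-Reasoning

module _ {A : Set} {λw : LeftWord A} {ρ : RightWord A} {u w₁ w′ w₂ v : List A} {q : ℕ}
         (left : IsLeftForm λw u w₁) (rightᵤ : IsRightForm ρ w′ u) (rightᵥ : IsRightForm ρ w₂ v)
         (|u|≡p : length u ≡ suc q) (|v|≡p : length v ≡ suc q) where

  -- λw (|w₁| + s) is the letter of u at q − (s mod p), and ρ (|w′| + t) the one at t mod p;
  -- an index J < |w′| is first pushed past |w′| using the period v of ρ.
  letters-match : ∀ {I J a b} → length w₁ ≤ I → length w₂ ≤ J →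
                  suc (I + J) + a * suc q ≡ length w₁ + length w′ + b * suc q → ρ J ≡ λw I
  letters-match {I} {J} {a} {b} w₁≤I w₂≤J congruent = begin
    ρ J                                        ≡⟨ rightForm-periodic rightᵥ |v|≡p w₂≤J (length w′) ⟨
    ρ (J + length w′ * suc q)                  ≡⟨ cong ρ J+W′p≡ ⟩
    ρ (length w′ + (e * suc q + t))            ≡⟨ just-injective (trans (sym (rightForm-letter rightᵤ |u|≡p e t<p))
                                                                         (leftForm-letter left |u|≡p c s+t+1≡p)) ⟩
    λw (length w₁ + (c * suc q + s))           ≡⟨ cong λw I≡ ⟨
    λw I                                       ∎
    where
    open ≡-Reasoning
    I′ = I ∸ length w₁
    s = I′ % suc q
    c = I′ / suc q
    J′ = J + length w′ * q
    t = J′ % suc q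
    e = J′ / suc q
    t<p : t < suc q
    t<p = m%n<n J′ (suc q)
    I≡ : I ≡ length w₁ + (c * suc q + s)
    I≡ = trans (sym (m+[n∸m]≡n w₁≤I)) (cong (length w₁ +_) (trans (m≡m%n+[m/n]*n I′ (suc q)) (+-comm s _)))
    J′≡ : J′ ≡ e * suc q + t
    J′≡ = trans (m≡m%n+[m/n]*n J′ (suc q)) (+-comm t _)
    J+W′p≡ : J + length w′ * suc q ≡ length w′ + (e * suc q + t)
    J+W′p≡ = trans (J+W′[1+q] J (length w′) q) (cong (length w′ +_) J′≡)
    s+t+1≡p : suc (s + t) ≡ suc q
    s+t+1≡p = complementary-residues (c + e + a) (length w′ + b) (m%n<n I′ (suc q)) t<p residues
      where
      residues : suc (s + t) + (c + e + a) * suc q ≡ (length w′ + b) * suc q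
      residues = residues-congruence (length w₁) (length w′) I J a b c e s t q I≡ J′≡ congruent

  rogWitness-within : length w₂ ≤ length w₁ → ∀ n →
    ∃[ r ] (r ≤ n × r ≤ length w₁ + q × RogWitness (suffixL λw n) (prefixR ρ n) r)
  rogWitness-within w₂≤w₁ n with n ≤? length w₁ + q
  ... | yes n≤M = n , ≤-refl , n≤M , prefixR ρ n , suffixL λw n , length-prefixR ρ n , length-suffixL λw n , refl
  ... | no  n≰M = r , r≤n , +-monoʳ-≤ (length w₁) d≤q ,
                  subst (λ N → RogWitness (suffixL λw N) (prefixR ρ N) r) r+m≡n (rogWitness-shift λw ρ r m agree)
    where
    -- d ≡ |w′| − n (mod p), since q ≡ −1
    X = length w′ + n * q
    d = X % suc q
    a = X / suc q
    d≤q : d ≤ q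
    d≤q = s≤s⁻¹ (m%n<n X (suc q))
    r = length w₁ + d
    r≤n : r ≤ n
    r≤n = ≤-trans (+-monoʳ-≤ (length w₁) d≤q) (<⇒≤ (≰⇒> n≰M))
    m = n ∸ r
    r+m≡n : r + m ≡ n
    r+m≡n = m+[n∸m]≡n r≤n
    w₁≤r+ : ∀ k → length w₁ ≤ r + k
    w₁≤r+ k = ≤-trans (m≤m+n (length w₁) d) (m≤m+n r k)
    agree : ∀ i j → suc (i + j) ≡ m → ρ (r + i) ≡ λw (r + j)
    agree i j 1+i+j≡m = letters-match {a = a} {b = n} (w₁≤r+ j) (≤-trans w₂≤w₁ (w₁≤r+ i))
      (choice-congruence (length w₁) (length w′) d a i j q (trans (cong (r +_) 1+i+j≡m) r+m≡n)
                         (m≡m%n+[m/n]*n X (suc q)))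

  rog-bound : length w₂ ≤ length w₁ → DecidableEquality A → ∀ n →
              ∃[ r ] (IsRog (suffixL λw n) (prefixR ρ n) r × r ≤ length w₁ + q)
  rog-bound w₂≤w₁ _≟_ n with rogWitness-within w₂≤w₁ n
  ... | B , B≤n , B≤M , B-witness
    with least-at-most B (λ m m<B → rogWitness? (length-suffixL λw n) (length-prefixR ρ n) (≤-trans (<⇒≤ m<B) B≤n) _≟_) B-witness
  ...   | r , r≤B , r-witness , r-least = r , (r-witness , r-least) , ≤-trans r≤B B≤M

lemma3p3 : (a : ℕ) (λw : LeftWord (Fin (suc a))) (ρ : RightWord (Fin (suc a)))
    → (∀ (z : List (Fin (suc a))) → IsLeftPeriod λw z ⇔ IsRightPeriod ρ z)
    → (u w₁ w₂ v : List (Fin (suc a)))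
    → IsLeftCanonical λw u w₁
    → IsRightCanonical ρ w₂ v
    → length w₁ ≥ length w₂
    → ∀ (n : ℕ) → ∃[ r ] (IsRog (suffixL λw n) (prefixR ρ n) r
                          × r ≤ length w₁ + length u ∸ 1)
lemma3p3 a λw ρ periods [] w₁ w₂ v (([]≢[] , _) , _) _ _ n = ⊥-elim ([]≢[] refl)
lemma3p3 a λw ρ periods u@(_ ∷ us) w₁ w₂ v (left , left-min) (right , right-min) w₂≤w₁ n
  with Equivalence.to (periods u) (w₁ , left) | Equivalence.from (periods v) (w₂ , right)
... | w′ , rightᵤ | w″ , leftᵥ =
  let r , r-rog , r≤M = rog-bound left rightᵤ right refl |v|≡|u| w₂≤w₁ _≟ᶠ_ n
  in  r , r-rog , subst (r ≤_) (sym (cong (_∸ 1) (+-suc (length w₁) (length us)))) r≤M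
  where
  |v|≡|u| : length v ≡ length u
  |v|≡|u| = ≤-antisym (proj₂ (right-min w′ u rightᵤ)) (proj₁ (left-min v w″ leftᵥ))
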